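{- Let $f\colon\mathbb F_2^n\to\mathbb F_2$ and $g\colon\mathbb F_2^m\to\mathbb F_2$ be Boolean functions and let $h(\mathbf{x},\mathbf{y})=f(\mathbf{x})\oplus g(\mathbf{y})$ for $\mathbf{x}\in\mathbb F_2^n$, $\mathbf{y}\in\mathbb F_2^m$, identifying $\mathbb F_2^{n+m}$ with $\mathbb F_2^n\times\mathbb F_2^m$. Then: (1) if $V\in\mathcal{RMS}(f)$ and $W\in\mathcal{RMS}(g)$, then $V\times W\in\mathcal{RMS}(h)$; (2) for every $U\in\mathcal{RMS}(h)$ there exist $V\in\mathcal{RMS}(f)$ and $W\in\mathcal{RMS}(g)$ such that $U\subseteq V\times W$; (3) $\operatorname{rind}(h)\le\operatorname{rind}(f)+\operatorname{rind}(g)$.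
   Context: For a Boolean function $F$ on $\mathbb F_2^N$ and $\mathbf{a},\mathbf{b}\in\mathbb F_2^N$, $D_{\mathbf{a},\mathbf{b}}F(\mathbf{z})=F(\mathbf{z}\oplus\mathbf{a}\oplus\mathbf{b})\oplus F(\mathbf{z}\oplus\mathbf{a})\oplus F(\mathbf{z}\oplus\mathbf{b})\oplus F(\mathbf{z})$. A vector subspace $U\le\mathbb F_2^N$ is a relaxed $\mathcal{M}$-subspace of $F$ if for all $\mathbf{a},\mathbf{b}\in U$, $D_{\mathbf{a},\mathbf{b}}F$ is a constant function (constant $0$ or constant $1$). $\mathcal{RMS}(F)$ is the collection of all relaxed $\mathcal{M}$-subspaces of $F$ of dimension $1,\dots,N$, and $\operatorname{rind}(F)=\max_{U\in\mathcal{RMS}(F)}\dim U$. -}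

module Defs where

open import Data.Bool using (Bool; true; false; _xor_)
open import Data.Nat using (ℕ; zero; suc; _+_; _≤_)
open import Data.Vec using (Vec; []; _∷_; zipWith; replicate; take; drop)
open import Data.Product using (Σ; ∃; _×_; _,_)
open import Data.Sum using (_⊎_)
open import Relation.Binary.PropositionalEquality using (_≡_)

F2^ : ℕ → Set
F2^ N = Vec Bool N

BoolFun : ℕ → Set
BoolFun N = F2^ N → Bool

_⊕_ : ∀ {N} → F2^ N → F2^ N → F2^ N
_⊕_ = zipWith _xor_

𝟎 : ∀ {N} → F2^ N
𝟎 = replicate _ false

D : ∀ {N} → F2^ N → F2^ N → BoolFun N → BoolFun N
D a b F z = F ((z ⊕ a) ⊕ b) xor F (z ⊕ a) xor F (z ⊕ b) xor F z

lincomb : ∀ {N d} → Vec Bool d → Vec (F2^ N) d → F2^ N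
lincomb []           []       = 𝟎
lincomb (true  ∷ c) (e ∷ es) = e ⊕ lincomb c es
lincomb (false ∷ c) (e ∷ es) = lincomb c es

LinIndep : ∀ {N d} → Vec (F2^ N) d → Set
LinIndep {d = d} es = ∀ c → lincomb c es ≡ 𝟎 → c ≡ replicate d false

IsSubspaceOfDim : ∀ {N} → (F2^ N → Set) → ℕ → Set
IsSubspaceOfDim {N} U d =
  Σ (Vec (F2^ N) d) λ es →
    LinIndep es × (∀ v → (U v → ∃ λ c → lincomb c es ≡ v)
                       × ((c : Vec Bool d) → U (lincomb c es)))

RelaxedM : ∀ {N} → BoolFun N → (F2^ N → Set) → Set
RelaxedM {N} F U = ∀ a b → U a → U b →
  (∀ z → D a b F z ≡ false) ⊎ (∀ z → D a b F z ≡ true)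

InRMS : ∀ {N} → BoolFun N → (F2^ N → Set) → Set
InRMS {N} F U = ∃ λ d → 1 ≤ d × d ≤ N × IsSubspaceOfDim U d × RelaxedM F U

HasDimRMS : ∀ {N} → BoolFun N → (F2^ N → Set) → ℕ → Set
HasDimRMS F U d = RelaxedM F U × IsSubspaceOfDim U d

-- r = rind(F) = max { dim U : U ∈ RMS(F) }, with the convention r = 0 if RMS(F) = ∅
IsRind : ∀ {N} → BoolFun N → ℕ → Set₁
IsRind {N} F r =
  (∀ (U : F2^ N → Set) d → 1 ≤ d → d ≤ N → HasDimRMS F U d → d ≤ r)
  × (r ≡ 0 ⊎ Σ (F2^ N → Set) λ U → 1 ≤ r × r ≤ N × HasDimRMS F U r)

-- identification F_2^{n+m} = F_2^n × F_2^m
h⟨_,_⟩ : ∀ {n m} → BoolFun n → BoolFun m → BoolFun (n + m)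
h⟨_,_⟩ {n} {m} f g v = f (take n v) xor g (drop n v)

_×ˢ_ : ∀ {n m} → (F2^ n → Set) → (F2^ m → Set) → (F2^ (n + m) → Set)
_×ˢ_ {n} {m} V W v = V (take n v) × W (drop n v)

{-# OPTIONS --safe #-}
-- D_{a,b} F is additive in F and commutes with precomposition by additive maps, so
-- D_{a,b} h (x ++ y) = D_{a₁,b₁} f x ⊕ D_{a₂,b₂} g y for a = a₁ ++ a₂ and b = b₁ ++ b₂.
-- Hence products of relaxed M-subspaces are relaxed for h, and conversely, freezing one
-- coordinate block, the two projections of a relaxed M-subspace U of h span relaxed
-- M-subspaces of f and g. U lies in the product of these spans, which gives (2), and a rank
-- count (an injection F₂^{dim U} → F₂^{d₁ + d₂}, hence 2^{dim U} ≤ 2^{d₁ + d₂}) gives (3).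
module Submission where

open import Algebra.Bundles using (AbelianGroup; CommutativeRing)
import Algebra.Properties.CommutativeSemigroup as CommutativeSemigroupProperties
import Algebra.Properties.Group as GroupProperties
import Algebra.Properties.Quasigroup as QuasigroupProperties
open import Data.Bool using (Bool; true; false; _xor_; _≟_)
open import Data.Bool.Properties
  using (xor-assoc; xor-comm; xor-identityˡ; xor-identityʳ; xor-same; xor-∧-commutativeRing)
open import Data.Fin using (Fin; zero)
open import Data.Fin.Properties using (2↔Bool; *↔×; injective⇒≤)
open import Data.Nat using (ℕ; zero; suc; _+_; _^_; _≤_; z≤n; s≤s)
open import Data.Nat.Properties using (≤-trans; m≤m+n; +-mono-≤; ≮⇒≥; <⇒≱; ^-monoʳ-<)
open import Data.Product using (Σ; ∃; _×_; _,_; proj₁; proj₂; uncurry)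
open import Data.Product.Function.NonDependent.Propositional using (_×-↔_)
open import Data.Empty using (⊥-elim)
open import Data.Sum using (_⊎_; inj₁; inj₂)
open import Data.Vec using (Vec; []; _∷_; _++_; map; take; drop; splitAt; uncons)
open import Data.Vec.Properties
  using (zipWith-assoc; zipWith-comm; zipWith-identityˡ; zipWith-identityʳ; zipWith-++;
         take-zipWith; drop-zipWith; take++drop≡id; ++-injective; ≡-dec)
open import Function using (_∘_; id)
open import Function.Bundles using (_↔_; _↣_; Injection; mk↔ₛ′; mk↣)
open import Function.Definitions using (Injective)
open import Function.Properties.Injection using (↣-trans)
open import Function.Properties.Inverse using (↔-sym; ↔-trans; ↔⇒↣)
open import Level using (0ℓ)
open import Relation.Binary.PropositionalEquality
  using (_≡_; refl; sym; trans; cong; cong₂; subst₂; isEquivalence; module ≡-Reasoning)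
open import Relation.Nullary using (¬_; yes; no)
open import Relation.Nullary.Decidable using (map′; _⊎-dec_)
open import Relation.Unary using (Pred; _⊆_; _≐_; Decidable)

open import Defs

private
  module Xor      = GroupProperties (CommutativeRing.+-group xor-∧-commutativeRing)
  module XorQuasi = QuasigroupProperties Xor.quasigroup
  module XorComm  = CommutativeSemigroupProperties (CommutativeRing.+-commutativeSemigroup xor-∧-commutativeRing)

xor-interchange : ∀ a b c d → (a xor b) xor (c xor d) ≡ (a xor c) xor (b xor d)
xor-interchange = XorComm.interchange

xor-leftComm : ∀ x y z → x xor (y xor z) ≡ y xor (x xor z)
xor-leftComm = XorComm.x∙yz≈y∙xz

xor-cancelˡ : ∀ x y → x xor (x xor y) ≡ y
xor-cancelˡ = Xor.\\-leftDividesˡ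

xor-pairs : ∀ x y → x xor x xor y xor y ≡ false
xor-pairs x y = trans (xor-cancelˡ x (y xor y)) (xor-same y)

xor-solveˡ : ∀ {x q k} → x xor q ≡ k → x ≡ k xor q
xor-solveˡ = XorQuasi.x≈z//y _ _ _

⊕-self : ∀ {N} (v : F2^ N) → v ⊕ v ≡ 𝟎
⊕-self []      = refl
⊕-self (x ∷ v) = cong₂ _∷_ (xor-same x) (⊕-self v)

⊕-abelianGroup : ℕ → AbelianGroup 0ℓ 0ℓ
⊕-abelianGroup N = record
  { Carrier        = F2^ N
  ; _≈_            = _≡_
  ; _∙_            = _⊕_
  ; ε              = 𝟎
  ; _⁻¹            = id
  ; isAbelianGroup = record
    { isGroup = record
      { isMonoid = record
        { isSemigroup = record
          { isMagma = record { isEquivalence = isEquivalence ; ∙-cong = cong₂ _⊕_ }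
          ; assoc   = zipWith-assoc xor-assoc
          }
        ; identity = zipWith-identityˡ xor-identityˡ , zipWith-identityʳ xor-identityʳ
        }
      ; inverse = ⊕-self , ⊕-self
      ; ⁻¹-cong = id
      }
    ; comm = zipWith-comm xor-comm
    }
  }

private
  module ⊕-Group {N} = AbelianGroup (⊕-abelianGroup N)
  module ⊕-Props {N} = GroupProperties (⊕-Group.group {N})
  module ⊕-Quasi {N} = QuasigroupProperties (⊕-Props.quasigroup {N})
  module ⊕-Comm {N} = CommutativeSemigroupProperties (⊕-Group.commutativeSemigroup {N})

⊕-assoc : ∀ {N} (u v w : F2^ N) → (u ⊕ v) ⊕ w ≡ u ⊕ (v ⊕ w)
⊕-assoc = ⊕-Group.assoc

⊕-identityˡ : ∀ {N} (v : F2^ N) → 𝟎 ⊕ v ≡ v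
⊕-identityˡ = ⊕-Group.identityˡ

⊕-identityʳ : ∀ {N} (v : F2^ N) → v ⊕ 𝟎 ≡ v
⊕-identityʳ = ⊕-Group.identityʳ

⊕-interchange : ∀ {N} (a b c d : F2^ N) → (a ⊕ b) ⊕ (c ⊕ d) ≡ (a ⊕ c) ⊕ (b ⊕ d)
⊕-interchange = ⊕-Comm.interchange

⊕-leftComm : ∀ {N} (u v w : F2^ N) → u ⊕ (v ⊕ w) ≡ v ⊕ (u ⊕ w)
⊕-leftComm = ⊕-Comm.x∙yz≈y∙xz

⊕≡𝟎⇒≡ : ∀ {N} {u v : F2^ N} → u ⊕ v ≡ 𝟎 → u ≡ v
⊕≡𝟎⇒≡ = ⊕-Props.inverseˡ-unique _ _

⊕-solveʳ : ∀ {N} {u v w : F2^ N} → u ⊕ v ≡ w → v ≡ u ⊕ w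
⊕-solveʳ = ⊕-Quasi.y≈x\\z _ _ _

⊕-cancelˡ : ∀ {N} (u v : F2^ N) → u ⊕ (u ⊕ v) ≡ v
⊕-cancelˡ = ⊕-Props.\\-leftDividesˡ

++-⊕ : ∀ {n m} (x x′ : F2^ n) (y y′ : F2^ m) → (x ++ y) ⊕ (x′ ++ y′) ≡ (x ⊕ x′) ++ (y ⊕ y′)
++-⊕ x x′ y y′ = zipWith-++ _xor_ x y x′ y′

𝟎-++ : ∀ n {m} → 𝟎 {n + m} ≡ 𝟎 {n} ++ 𝟎 {m}
𝟎-++ zero    = refl
𝟎-++ (suc n) = cong (false ∷_) (𝟎-++ n)

take-drop-++ : ∀ {A : Set} {n m} (x : Vec A n) (y : Vec A m) → take n (x ++ y) ≡ x × drop n (x ++ y) ≡ y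
take-drop-++ {n = n} x y = ++-injective (take n (x ++ y)) x (take++drop≡id n (x ++ y))

Vec-Bool↔Fin : ∀ d → Vec Bool d ↔ Fin (2 ^ d)
Vec-Bool↔Fin zero    = mk↔ₛ′ (λ _ → zero) (λ _ → []) (λ { zero → refl }) (λ { [] → refl })
Vec-Bool↔Fin (suc d) = ↔-trans ∷↔× (↔-trans (↔-sym 2↔Bool ×-↔ Vec-Bool↔Fin d) (↔-sym *↔×))
  where
  ∷↔× : Vec Bool (suc d) ↔ (Bool × Vec Bool d)
  ∷↔× = mk↔ₛ′ uncons (uncurry _∷_) (λ _ → refl) (λ { (_ ∷ _) → refl })

injective⇒length-≤ : ∀ {d k} {G : Vec Bool d → Vec Bool k} → Injective _≡_ _≡_ G → d ≤ k
injective⇒length-≤ {d} {k} G-injective =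
  ≮⇒≥ λ k<d → <⇒≱ (^-monoʳ-< 2 (s≤s (s≤s z≤n)) k<d) (injective⇒≤ (Injection.injective fin↣))
  where
  fin↣ : Fin (2 ^ d) ↣ Fin (2 ^ k)
  fin↣ = ↣-trans (↔⇒↣ (↔-sym (Vec-Bool↔Fin d))) (↣-trans (mk↣ G-injective) (↔⇒↣ (Vec-Bool↔Fin k)))

Additive : ∀ {N M} → (F2^ N → F2^ M) → Set
Additive φ = ∀ u v → φ (u ⊕ v) ≡ φ u ⊕ φ v

additive⇒𝟎 : ∀ {N M} {φ : F2^ N → F2^ M} → Additive φ → φ 𝟎 ≡ 𝟎
additive⇒𝟎 {φ = φ} φ-additive =
  trans (cong φ (sym (⊕-self 𝟎))) (trans (φ-additive 𝟎 𝟎) (⊕-self (φ 𝟎)))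

take-additive : ∀ n {m} → Additive (take n {m})
take-additive n = take-zipWith _xor_

drop-additive : ∀ n {m} → Additive (drop n {m})
drop-additive n = drop-zipWith _xor_

++𝟎-additive : ∀ {n} m → Additive (λ (x : F2^ n) → x ++ 𝟎 {m})
++𝟎-additive m x y = sym (trans (++-⊕ x y 𝟎 𝟎) (cong ((x ⊕ y) ++_) (⊕-self 𝟎)))

𝟎++-additive : ∀ n {m} → Additive (λ (y : F2^ m) → 𝟎 {n} ++ y)
𝟎++-additive n x y = sym (trans (++-⊕ 𝟎 𝟎 x y) (cong (_++ (x ⊕ y)) (⊕-self 𝟎)))

D-∘ : ∀ {N M} (F : BoolFun M) {φ : F2^ N → F2^ M} → Additive φ →
      ∀ a b z → D a b (F ∘ φ) z ≡ D (φ a) (φ b) F (φ z)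
D-∘ F φ-additive a b z
  rewrite φ-additive (z ⊕ a) b | φ-additive z a | φ-additive z b = refl

D-xor : ∀ {N} (F G : BoolFun N) a b z →
        D a b (λ v → F v xor G v) z ≡ D a b F z xor D a b G z
D-xor F G a b z =
  trans (cong ((F₁ xor G₁) xor_) (cong ((F₂ xor G₂) xor_) (xor-interchange F₃ G₃ F₄ G₄)))
 (trans (cong ((F₁ xor G₁) xor_) (xor-interchange F₂ G₂ (F₃ xor F₄) (G₃ xor G₄)))
        (xor-interchange F₁ G₁ (F₂ xor F₃ xor F₄) (G₂ xor G₃ xor G₄)))
  where
  F₁ F₂ F₃ F₄ G₁ G₂ G₃ G₄ : Bool
  F₁ = F ((z ⊕ a) ⊕ b); F₂ = F (z ⊕ a); F₃ = F (z ⊕ b); F₄ = F z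
  G₁ = G ((z ⊕ a) ⊕ b); G₂ = G (z ⊕ a); G₃ = G (z ⊕ b); G₄ = G z

D-h⟨,⟩ : ∀ {n m} (f : BoolFun n) (g : BoolFun m) a b z →
         D a b h⟨ f , g ⟩ z ≡ D (take n a) (take n b) f (take n z) xor D (drop n a) (drop n b) g (drop n z)
D-h⟨,⟩ {n} f g a b z =
  trans (D-xor (f ∘ take n) (g ∘ drop n) a b z)
        (cong₂ _xor_ (D-∘ f (take-additive n) a b z) (D-∘ g (drop-additive n) a b z))

D-h⟨,⟩-++ : ∀ {n m} (f : BoolFun n) (g : BoolFun m) a b x y →
            D a b h⟨ f , g ⟩ (x ++ y) ≡ D (take n a) (take n b) f x xor D (drop n a) (drop n b) g y
D-h⟨,⟩-++ {n} f g a b x y with take-drop-++ x y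
... | take≡x , drop≡y = trans (D-h⟨,⟩ f g a b (x ++ y))
  (cong₂ (λ s t → D (take n a) (take n b) f s xor D (drop n a) (drop n b) g t) take≡x drop≡y)

D-zeroʳ : ∀ {N} (F : BoolFun N) a z → D a 𝟎 F z ≡ false
D-zeroʳ F a z rewrite ⊕-identityʳ (z ⊕ a) | ⊕-identityʳ z = xor-pairs (F (z ⊕ a)) (F z)

D-zeroˡ : ∀ {N} (F : BoolFun N) b z → D 𝟎 b F z ≡ false
D-zeroˡ F b z rewrite ⊕-identityʳ z =
  trans (cong (F (z ⊕ b) xor_) (xor-leftComm (F z) (F (z ⊕ b)) (F z)))
        (xor-pairs (F (z ⊕ b)) (F z))

D-diag : ∀ {N} (F : BoolFun N) a z → D a a F z ≡ false
D-diag F a z rewrite ⊕-assoc z a a | ⊕-self a | ⊕-identityʳ z =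
  trans (cong (F z xor_) (xor-cancelˡ (F (z ⊕ a)) (F z))) (xor-same (F z))

Constant : ∀ {A : Set} → (A → Bool) → Set
Constant P = ∃ λ k → ∀ z → P z ≡ k

mkRelaxedM : ∀ {N} {F : BoolFun N} {U : Pred (F2^ N) 0ℓ} →
             (∀ {a b} → U a → U b → Constant (D a b F)) → RelaxedM F U
mkRelaxedM const a b Ua Ub with const Ua Ub
... | false , D≡false = inj₁ D≡false
... | true  , D≡true  = inj₂ D≡true

RelaxedM⇒constant : ∀ {N} {F : BoolFun N} {U : Pred (F2^ N) 0ℓ} →
                    RelaxedM F U → ∀ {a b} → U a → U b → Constant (D a b F)
RelaxedM⇒constant rel {a} {b} Ua Ub with rel a b Ua Ub
... | inj₁ D≡false = false , D≡false
... | inj₂ D≡true  = true  , D≡true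

RelaxedM-antimono : ∀ {N} {F : BoolFun N} {U V : Pred (F2^ N) 0ℓ} → U ⊆ V → RelaxedM F V → RelaxedM F U
RelaxedM-antimono U⊆V rel a b Ua Ub = rel a b (U⊆V Ua) (U⊆V Ub)

RelaxedM-×ˢ : ∀ {n m} {f : BoolFun n} {g : BoolFun m} {V : Pred (F2^ n) 0ℓ} {W : Pred (F2^ m) 0ℓ} →
              RelaxedM f V → RelaxedM g W → RelaxedM h⟨ f , g ⟩ (V ×ˢ W)
RelaxedM-×ˢ {f = f} {g} relV relW = mkRelaxedM {F = h⟨ f , g ⟩} λ {a} {b} (Va , Wa) (Vb , Wb) →
  let kf , Df≡kf = RelaxedM⇒constant {F = f} relV Va Vb
      kg , Dg≡kg = RelaxedM⇒constant {F = g} relW Wa Wb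
  in kf xor kg , λ z → trans (D-h⟨,⟩ f g a b z) (cong₂ _xor_ (Df≡kf _) (Dg≡kg _))

-- At z = x ++ 𝟎 the g-summand of D h is D g 𝟎, independent of x.
constant-take : ∀ {n m} {f : BoolFun n} {g : BoolFun m} {a b} →
                Constant (D a b h⟨ f , g ⟩) → Constant (D (take n a) (take n b) f)
constant-take {n} {f = f} {g} {a} {b} (k , Dh≡k) =
  k xor D (drop n a) (drop n b) g 𝟎 , λ x → xor-solveˡ (trans (sym (D-h⟨,⟩-++ f g a b x 𝟎)) (Dh≡k (x ++ 𝟎)))

constant-drop : ∀ {n m} {f : BoolFun n} {g : BoolFun m} {a b} →
                Constant (D a b h⟨ f , g ⟩) → Constant (D (drop n a) (drop n b) g)
constant-drop {n} {f = f} {g} {a} {b} (k , Dh≡k) =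
  k xor D (take n a) (take n b) f 𝟎 , λ y → xor-solveˡ (trans (xor-comm _ (D (take n a) (take n b) f 𝟎))
    (trans (sym (D-h⟨,⟩-++ f g a b 𝟎 y)) (Dh≡k (𝟎 ++ y))))

Span : ∀ {N d} → Vec (F2^ N) d → Pred (F2^ N) 0ℓ
Span es v = ∃ λ c → lincomb c es ≡ v

lincomb-⊕ : ∀ {N d} (c c′ : Vec Bool d) (es : Vec (F2^ N) d) →
            lincomb c es ⊕ lincomb c′ es ≡ lincomb (c ⊕ c′) es
lincomb-⊕ []          []           []       = ⊕-self 𝟎
lincomb-⊕ (true ∷ c)  (true ∷ c′)  (e ∷ es) =
  trans (⊕-interchange e _ e _) (trans (cong (_⊕ _) (⊕-self e)) (trans (⊕-identityˡ _) (lincomb-⊕ c c′ es)))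
lincomb-⊕ (true ∷ c)  (false ∷ c′) (e ∷ es) = trans (⊕-assoc e _ _) (cong (e ⊕_) (lincomb-⊕ c c′ es))
lincomb-⊕ (false ∷ c) (true ∷ c′)  (e ∷ es) = trans (⊕-leftComm _ e _) (cong (e ⊕_) (lincomb-⊕ c c′ es))
lincomb-⊕ (false ∷ c) (false ∷ c′) (e ∷ es) = lincomb-⊕ c c′ es

lincomb-injective : ∀ {N d} {es : Vec (F2^ N) d} → LinIndep es → Injective _≡_ _≡_ (λ c → lincomb c es)
lincomb-injective {es = es} independent {c} {c′} eq = ⊕≡𝟎⇒≡ (independent (c ⊕ c′)
  (trans (sym (lincomb-⊕ c c′ es)) (trans (cong (_⊕ lincomb c′ es) eq) (⊕-self _))))

lincomb-map : ∀ {N M d} {φ : F2^ N → F2^ M} → Additive φ →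
              (c : Vec Bool d) (es : Vec (F2^ N) d) → lincomb c (map φ es) ≡ φ (lincomb c es)
lincomb-map φ-additive []          []       = sym (additive⇒𝟎 φ-additive)
lincomb-map φ-additive (true ∷ c)  (e ∷ es) =
  trans (cong (_ ⊕_) (lincomb-map φ-additive c es)) (sym (φ-additive e _))
lincomb-map φ-additive (false ∷ c) (e ∷ es) = lincomb-map φ-additive c es

lincomb-++ : ∀ {N d₁ d₂} (c₁ : Vec Bool d₁) (c₂ : Vec Bool d₂) (es₁ : Vec (F2^ N) d₁) es₂ →
             lincomb (c₁ ++ c₂) (es₁ ++ es₂) ≡ lincomb c₁ es₁ ⊕ lincomb c₂ es₂
lincomb-++ []           c₂ []        es₂ = sym (⊕-identityˡ _)
lincomb-++ (true ∷ c₁)  c₂ (e ∷ es₁) es₂ =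
  trans (cong (e ⊕_) (lincomb-++ c₁ c₂ es₁ es₂)) (sym (⊕-assoc e _ _))
lincomb-++ (false ∷ c₁) c₂ (e ∷ es₁) es₂ = lincomb-++ c₁ c₂ es₁ es₂

Span-⊕ : ∀ {N d} {es : Vec (F2^ N) d} {u v} → Span es u → Span es v → Span es (u ⊕ v)
Span-⊕ {es = es} (c , refl) (c′ , refl) = c ⊕ c′ , sym (lincomb-⊕ c c′ es)

Span-map : ∀ {N M d} {φ : F2^ N → F2^ M} → Additive φ →
           {es : Vec (F2^ N) d} {v : F2^ N} → Span es v → Span (map φ es) (φ v)
Span-map φ-additive {es} (c , refl) = c , lincomb-map φ-additive c es

Span-∷⁺ : ∀ {N d} {e : F2^ N} {es : Vec (F2^ N) d} → Span es ⊆ Span (e ∷ es)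
Span-∷⁺ (c , p) = false ∷ c , p

Span-∷-mono : ∀ {N d k} {e : F2^ N} {es : Vec (F2^ N) d} {fs : Vec (F2^ N) k} →
              Span es ⊆ Span fs → Span (e ∷ es) ⊆ Span (e ∷ fs)
Span-∷-mono es⊆fs (false ∷ c , p) = Span-∷⁺ (es⊆fs (c , p))
Span-∷-mono es⊆fs (true ∷ c , refl) with es⊆fs (c , refl)
... | c′ , q = true ∷ c′ , cong (_ ⊕_) q

Span-∷-⊆ : ∀ {N d k} {e : F2^ N} {es : Vec (F2^ N) d} {fs : Vec (F2^ N) k} →
           Span fs e → Span es ⊆ Span fs → Span (e ∷ es) ⊆ Span fs
Span-∷-⊆ e∈fs es⊆fs (false ∷ c , p)    = es⊆fs (c , p)
Span-∷-⊆ e∈fs es⊆fs (true ∷ c , refl) = Span-⊕ e∈fs (es⊆fs (c , refl))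

Span? : ∀ {N d} (es : Vec (F2^ N) d) → Decidable (Span es)
Span? []       v = map′ ([] ,_) (λ { ([] , p) → p }) (≡-dec _≟_ 𝟎 v)
Span? (e ∷ es) v = map′ fromSplit toSplit (Span? es v ⊎-dec Span? es (e ⊕ v))
  where
  fromSplit : Span es v ⊎ Span es (e ⊕ v) → Span (e ∷ es) v
  fromSplit (inj₁ (c , p)) = false ∷ c , p
  fromSplit (inj₂ (c , p)) = true ∷ c , trans (cong (e ⊕_) p) (⊕-cancelˡ e v)
  toSplit : Span (e ∷ es) v → Span es v ⊎ Span es (e ⊕ v)
  toSplit (false ∷ c , p) = inj₁ (c , p)
  toSplit (true ∷ c , p)  = inj₂ (c , ⊕-solveʳ p)

LinIndep-[] : ∀ {N} → LinIndep {N} []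
LinIndep-[] [] _ = refl

LinIndep-∷ : ∀ {N d} {e : F2^ N} {es : Vec (F2^ N) d} → ¬ Span es e → LinIndep es → LinIndep (e ∷ es)
LinIndep-∷ e∉es independent (true ∷ c)  eq = ⊥-elim (e∉es (c , sym (⊕≡𝟎⇒≡ eq)))
LinIndep-∷ e∉es independent (false ∷ c) eq = cong (false ∷_) (independent c eq)

LinIndep⇒length≤ : ∀ {N d} {es : Vec (F2^ N) d} → LinIndep es → d ≤ N
LinIndep⇒length≤ independent = injective⇒length-≤ (lincomb-injective independent)

LinIndep⇒rank≤ : ∀ {N d k} {es : Vec (F2^ N) d} {fs : Vec (F2^ N) k} →
                 LinIndep es → Span es ⊆ Span fs → d ≤ k
LinIndep⇒rank≤ {d = d} {k} {es} {fs} independent es⊆fs =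
  injective⇒length-≤ {G = coordinates} coordinates-injective
  where
  coordinates : Vec Bool d → Vec Bool k
  coordinates c = proj₁ (es⊆fs (c , refl))
  coordinates-injective : Injective _≡_ _≡_ coordinates
  coordinates-injective {c} {c′} eq = lincomb-injective independent
    (trans (sym (proj₂ (es⊆fs (c , refl)))) (trans (cong (λ x → lincomb x fs) eq) (proj₂ (es⊆fs (c′ , refl)))))

record Basis {N k} (ps : Vec (F2^ N) k) : Set where
  field
    dim         : ℕ
    vectors     : Vec (F2^ N) dim
    independent : LinIndep vectors
    spans       : Span vectors ≐ Span ps

basis : ∀ {N k} (ps : Vec (F2^ N) k) → Basis ps
basis []       = record { vectors = [] ; independent = LinIndep-[] ; spans = id , id }
basis (p ∷ ps) with basis ps
... | record { vectors = bs ; independent = independent ; spans = bs⊆ps , ps⊆bs } with Span? bs p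
...   | yes p∈bs = record { vectors = bs ; independent = independent
                          ; spans = Span-∷⁺ ∘ bs⊆ps , Span-∷-⊆ p∈bs ps⊆bs }
...   | no  p∉bs = record { vectors = p ∷ bs ; independent = LinIndep-∷ p∉bs independent
                          ; spans = Span-∷-mono bs⊆ps , Span-∷-mono ps⊆bs }

≐Span⇒IsSubspaceOfDim : ∀ {N d} {U : Pred (F2^ N) 0ℓ} {es : Vec (F2^ N) d} →
                        LinIndep es → U ≐ Span es → IsSubspaceOfDim U d
≐Span⇒IsSubspaceOfDim {es = es} independent (U⊆es , es⊆U) =
  es , independent , λ _ → U⊆es , λ c → es⊆U (c , refl)

IsSubspaceOfDim⇒≐Span : ∀ {N d} {U : Pred (F2^ N) 0ℓ} → IsSubspaceOfDim U d →
                        Σ (Vec (F2^ N) d) λ es → LinIndep es × U ≐ Span es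
IsSubspaceOfDim⇒≐Span (es , independent , members) =
  es , independent , (λ {v} → proj₁ (members v)) , λ { (c , refl) → proj₂ (members 𝟎) c }

productBasis : ∀ {n m d₁ d₂} → Vec (F2^ n) d₁ → Vec (F2^ m) d₂ → Vec (F2^ (n + m)) (d₁ + d₂)
productBasis {n} {m} es₁ es₂ = map (_++ 𝟎 {m}) es₁ ++ map (𝟎 {n} ++_) es₂

lincomb-productBasis : ∀ {n m d₁ d₂} (c₁ : Vec Bool d₁) (c₂ : Vec Bool d₂) es₁ es₂ →
  lincomb (c₁ ++ c₂) (productBasis {n} {m} es₁ es₂) ≡ lincomb c₁ es₁ ++ lincomb c₂ es₂
lincomb-productBasis {n} {m} c₁ c₂ es₁ es₂ = begin
  lincomb (c₁ ++ c₂) (productBasis es₁ es₂)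
    ≡⟨ lincomb-++ c₁ c₂ _ _ ⟩
  lincomb c₁ (map (_++ 𝟎) es₁) ⊕ lincomb c₂ (map (𝟎 ++_) es₂)
    ≡⟨ cong₂ _⊕_ (lincomb-map (++𝟎-additive m) c₁ es₁) (lincomb-map (𝟎++-additive n) c₂ es₂) ⟩
  (lincomb c₁ es₁ ++ 𝟎) ⊕ (𝟎 ++ lincomb c₂ es₂)
    ≡⟨ ++-⊕ (lincomb c₁ es₁) 𝟎 𝟎 (lincomb c₂ es₂) ⟩
  (lincomb c₁ es₁ ⊕ 𝟎) ++ (𝟎 ⊕ lincomb c₂ es₂)
    ≡⟨ cong₂ _++_ (⊕-identityʳ (lincomb c₁ es₁)) (⊕-identityˡ (lincomb c₂ es₂)) ⟩
  lincomb c₁ es₁ ++ lincomb c₂ es₂ ∎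
  where open ≡-Reasoning

Span-productBasis : ∀ {n m d₁ d₂} (es₁ : Vec (F2^ n) d₁) (es₂ : Vec (F2^ m) d₂) →
                    Span (productBasis es₁ es₂) ≐ (Span es₁ ×ˢ Span es₂)
Span-productBasis {n} {d₁ = d₁} es₁ es₂ = split , join
  where
  split : Span (productBasis es₁ es₂) ⊆ (Span es₁ ×ˢ Span es₂)
  split (c , refl) with splitAt d₁ c
  ... | c₁ , c₂ , refl with take-drop-++ (lincomb c₁ es₁) (lincomb c₂ es₂)
  ...   | take≡ , drop≡ = (c₁ , sym (trans (cong (take n) (lincomb-productBasis c₁ c₂ es₁ es₂)) take≡))
                        , (c₂ , sym (trans (cong (drop n) (lincomb-productBasis c₁ c₂ es₁ es₂)) drop≡))
  join : (Span es₁ ×ˢ Span es₂) ⊆ Span (productBasis es₁ es₂)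
  join {v} ((c₁ , p₁) , (c₂ , p₂)) =
    c₁ ++ c₂ , trans (lincomb-productBasis c₁ c₂ es₁ es₂) (trans (cong₂ _++_ p₁ p₂) (take++drop≡id n v))

×ˢ-≐Span : ∀ {n m d₁ d₂} {V : Pred (F2^ n) 0ℓ} {W : Pred (F2^ m) 0ℓ} {es₁ : Vec (F2^ n) d₁} {es₂ : Vec (F2^ m) d₂} →
           V ≐ Span es₁ → W ≐ Span es₂ → (V ×ˢ W) ≐ Span (productBasis es₁ es₂)
×ˢ-≐Span {es₁ = es₁} {es₂} (V⊆es₁ , es₁⊆V) (W⊆es₂ , es₂⊆W) =
  (λ (Vx , Wy) → proj₂ (Span-productBasis es₁ es₂) (V⊆es₁ Vx , W⊆es₂ Wy)) ,
  (λ v∈ → let x∈ , y∈ = proj₁ (Span-productBasis es₁ es₂) v∈ in es₁⊆V x∈ , es₂⊆W y∈)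

LinIndep-productBasis : ∀ {n m d₁ d₂} {es₁ : Vec (F2^ n) d₁} {es₂ : Vec (F2^ m) d₂} →
                        LinIndep es₁ → LinIndep es₂ → LinIndep (productBasis es₁ es₂)
LinIndep-productBasis {n} {d₁ = d₁} {es₁ = es₁} {es₂} independent₁ independent₂ c eq with splitAt d₁ c
... | c₁ , c₂ , refl with ++-injective (lincomb c₁ es₁) 𝟎
                          (trans (sym (lincomb-productBasis c₁ c₂ es₁ es₂)) (trans eq (𝟎-++ n)))
...   | eq₁ , eq₂ = trans (cong₂ _++_ (independent₁ c₁ eq₁) (independent₂ c₂ eq₂)) (sym (𝟎-++ d₁))

RelaxedM-line : ∀ {N} (F : BoolFun N) (e : F2^ N) → RelaxedM F (Span (e ∷ []))
RelaxedM-line F e _ _ (false ∷ [] , refl) _                   = inj₁ (D-zeroˡ F _)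
RelaxedM-line F e _ _ (true ∷ [] , refl) (false ∷ [] , refl) = inj₁ (D-zeroʳ F _)
RelaxedM-line F e _ _ (true ∷ [] , refl) (true ∷ [] , refl)  = inj₁ (D-diag F _)

RelaxedM-map : ∀ {N M d} {H : BoolFun N} {F : BoolFun M} {φ : F2^ N → F2^ M} → Additive φ →
               (∀ {a b} → Constant (D a b H) → Constant (D (φ a) (φ b) F)) →
               {es : Vec (F2^ N) d} → RelaxedM H (Span es) → RelaxedM F (Span (map φ es))
RelaxedM-map {H = H} {F} φ-additive transfer {es} rel =
  mkRelaxedM {F = F} λ { (c , refl) (c′ , refl) →
    subst₂ (λ a b → Constant (D a b F)) (sym (lincomb-map φ-additive c es)) (sym (lincomb-map φ-additive c′ es))
      (transfer (RelaxedM⇒constant {F = H} rel (c , refl) (c′ , refl))) }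

record RelaxedCover {N} (F : BoolFun N) (P : Pred (F2^ N) 0ℓ) : Set where
  field
    dim         : ℕ
    vectors     : Vec (F2^ N) dim
    independent : LinIndep vectors
    relaxed     : RelaxedM F (Span vectors)
    covers      : P ⊆ Span vectors

relaxedCover : ∀ {N k} {F : BoolFun N} {ps : Vec (F2^ N) k} → RelaxedM F (Span ps) → RelaxedCover F (Span ps)
relaxedCover {F = F} {ps} rel = record
  { vectors = vectors ; independent = independent
  ; relaxed = RelaxedM-antimono {F = F} (proj₁ spans) rel ; covers = proj₂ spans }
  where open Basis (basis ps)

Span-InRMS : ∀ {N d} {F : BoolFun N} {es : Vec (F2^ N) (suc d)} →
             LinIndep es → RelaxedM F (Span es) → InRMS F (Span es)
Span-InRMS independent rel =
  _ , s≤s z≤n , LinIndep⇒length≤ independent , ≐Span⇒IsSubspaceOfDim independent (id , id) , rel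

-- A cover of dimension 0 is enlarged to a line, since RMS(F) only has subspaces of dimension ≥ 1.
RelaxedCover⇒InRMS : ∀ {N} {F : BoolFun N} {P : Pred (F2^ N) 0ℓ} → 1 ≤ N → RelaxedCover F P →
                     Σ (Pred (F2^ N) 0ℓ) λ V → InRMS F V × P ⊆ V
RelaxedCover⇒InRMS {suc N} {F} _ record { vectors = [] ; covers = covers } =
  Span (e₀ ∷ []) , Span-InRMS {F = F} (LinIndep-∷ (λ { ([] , ()) }) LinIndep-[]) (RelaxedM-line F e₀) ,
  λ Pv → zeroSpan⊆line (covers Pv)
  where
  e₀ : F2^ (suc N)
  e₀ = true ∷ 𝟎
  zeroSpan⊆line : Span [] ⊆ Span (e₀ ∷ [])
  zeroSpan⊆line ([] , 𝟎≡v) = false ∷ [] , 𝟎≡v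
RelaxedCover⇒InRMS {F = F} _
  record { vectors = _ ∷ _ ; independent = independent ; relaxed = rel ; covers = covers } =
  _ , Span-InRMS {F = F} independent rel , covers

RelaxedCover-dim≤rind : ∀ {N r} {F : BoolFun N} {P : Pred (F2^ N) 0ℓ} → IsRind F r →
                        (C : RelaxedCover F P) → RelaxedCover.dim C ≤ r
RelaxedCover-dim≤rind _ record { vectors = [] } = z≤n
RelaxedCover-dim≤rind (maximal , _)
  record { vectors = es@(_ ∷ _) ; independent = independent ; relaxed = rel } =
  maximal (Span es) _ (s≤s z≤n) (LinIndep⇒length≤ independent) (rel , ≐Span⇒IsSubspaceOfDim independent (id , id))

takeCover : ∀ {n m d} {f : BoolFun n} {g : BoolFun m} {es : Vec (F2^ (n + m)) d} →
            RelaxedM h⟨ f , g ⟩ (Span es) → RelaxedCover f (Span (map (take n) es))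
takeCover {n} {f = f} {g} rel =
  relaxedCover {F = f} (RelaxedM-map {H = h⟨ f , g ⟩} {f} (take-additive n) (constant-take {f = f} {g}) rel)

dropCover : ∀ {n m d} {f : BoolFun n} {g : BoolFun m} {es : Vec (F2^ (n + m)) d} →
            RelaxedM h⟨ f , g ⟩ (Span es) → RelaxedCover g (Span (map (drop n) es))
dropCover {n} {f = f} {g} rel =
  relaxedCover {F = g} (RelaxedM-map {H = h⟨ f , g ⟩} {g} (drop-additive n) (constant-drop {f = f} {g}) rel)

InRMS-×ˢ : ∀ {n m} {f : BoolFun n} {g : BoolFun m} {V : Pred (F2^ n) 0ℓ} {W : Pred (F2^ m) 0ℓ} →
           InRMS f V → InRMS g W → InRMS h⟨ f , g ⟩ (V ×ˢ W)
InRMS-×ˢ {f = f} {g} (d₁ , 1≤d₁ , d₁≤n , subV , relV) (d₂ , _ , d₂≤m , subW , relW) =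
  let es₁ , independent₁ , V≐es₁ = IsSubspaceOfDim⇒≐Span subV
      es₂ , independent₂ , W≐es₂ = IsSubspaceOfDim⇒≐Span subW
  in d₁ + d₂ , ≤-trans 1≤d₁ (m≤m+n d₁ d₂) , +-mono-≤ d₁≤n d₂≤m
   , ≐Span⇒IsSubspaceOfDim (LinIndep-productBasis independent₁ independent₂) (×ˢ-≐Span V≐es₁ W≐es₂)
   , RelaxedM-×ˢ {f = f} {g} relV relW

InRMS-h⟨,⟩⇒⊆×ˢ : ∀ {n m} {f : BoolFun n} {g : BoolFun m} → 1 ≤ n → 1 ≤ m →
                 ∀ (U : Pred (F2^ (n + m)) 0ℓ) → InRMS h⟨ f , g ⟩ U →
                 Σ (Pred (F2^ n) 0ℓ) λ V → Σ (Pred (F2^ m) 0ℓ) λ W →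
                   InRMS f V × InRMS g W × (∀ v → U v → (V ×ˢ W) v)
InRMS-h⟨,⟩⇒⊆×ˢ {n} {m} {f} {g} 1≤n 1≤m U (_ , _ , _ , subU , relU) =
  let es , _ , U⊆es , es⊆U = IsSubspaceOfDim⇒≐Span subU
      rel = RelaxedM-antimono {F = h⟨ f , g ⟩} es⊆U relU
      V , V∈ , V⊇ = RelaxedCover⇒InRMS 1≤n (takeCover {f = f} {g} rel)
      W , W∈ , W⊇ = RelaxedCover⇒InRMS 1≤m (dropCover {f = f} {g} rel)
  in V , W , V∈ , W∈ , λ u Uu →
     V⊇ (Span-map (take-additive n) (U⊆es Uu)) , W⊇ (Span-map (drop-additive n) (U⊆es Uu))

rind-h⟨,⟩≤ : ∀ {n m} {f : BoolFun n} {g : BoolFun m} rf rg rh →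
             IsRind f rf → IsRind g rg → IsRind h⟨ f , g ⟩ rh → rh ≤ rf + rg
rind-h⟨,⟩≤ _ _ _ _ _ (_ , inj₁ refl) = z≤n
rind-h⟨,⟩≤ {n} {f = f} {g} _ _ _ rind-f rind-g (_ , inj₂ (U , _ , _ , relU , subU)) =
  let es , independent , U⊆es , es⊆U = IsSubspaceOfDim⇒≐Span subU
      rel = RelaxedM-antimono {F = h⟨ f , g ⟩} es⊆U relU
      Cf = takeCover {f = f} {g} rel
      Cg = dropCover {f = f} {g} rel
      es⊆CfCg : Span es ⊆ Span (productBasis (RelaxedCover.vectors Cf) (RelaxedCover.vectors Cg))
      es⊆CfCg u∈ = proj₂ (Span-productBasis _ _)
        ( RelaxedCover.covers Cf (Span-map (take-additive n) u∈)
        , RelaxedCover.covers Cg (Span-map (drop-additive n) u∈))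
  in ≤-trans (LinIndep⇒rank≤ independent es⊆CfCg)
             (+-mono-≤ (RelaxedCover-dim≤rind rind-f Cf) (RelaxedCover-dim≤rind rind-g Cg))

mainTheorem7 : ∀ (n m : ℕ) (f : BoolFun n) (g : BoolFun m) →
      (∀ (V : F2^ n → Set) (W : F2^ m → Set) →
          InRMS f V → InRMS g W → InRMS h⟨ f , g ⟩ (V ×ˢ W))
    × (1 ≤ n → 1 ≤ m → ∀ (U : F2^ (n + m) → Set) → InRMS h⟨ f , g ⟩ U →
          Σ (F2^ n → Set) λ V → Σ (F2^ m → Set) λ W →
            InRMS f V × InRMS g W × (∀ v → U v → (V ×ˢ W) v))
    × (∀ rf rg rh → IsRind f rf → IsRind g rg → IsRind h⟨ f , g ⟩ rh → rh ≤ rf + rg)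
mainTheorem7 n m f g =
    (λ V W → InRMS-×ˢ {f = f} {g} {V} {W})
  , InRMS-h⟨,⟩⇒⊆×ˢ {f = f} {g}
  , rind-h⟨,⟩≤ {f = f} {g}
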